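{- Let $k>t\ge1$, $r\ge5$ and $n\ge k+rt$ be integers. Let $s=\lceil r/3\rceil$, or, if $r\equiv1\pmod3$, possibly $s=\lfloor r/3\rfloor$. Let $\mathcal{F}=\mathcal{I}_1\cup\dots\cup\mathcal{I}_s$ where $\mathcal{I}_1,\dots,\mathcal{I}_s\subseteq\binom{[n]}{k}$ are distinct $t$-stars with centres $T_1,\dots,T_s$, and suppose $|T_1\cap T_s|\ge\max(1,2t-k)$. Let $\tilde{\mathcal{F}}=\mathcal{I}_1\cup\dots\cup\mathcal{I}_{s-1}\cup\tilde{\mathcal{I}}_s$, where $\tilde{\mathcal{I}}_s$ is a $t$-star whose centre $\tilde T_s$ is disjoint from $T_1\cup\dots\cup T_s$. For $\vec C\in\mathfrak{C}$, let $\Phi(\vec C)$ and $\tilde\Phi(\vec C)$ be the corresponding colourings of $\mathcal{F}$ and $\tilde{\mathcal{F}}$ respectively. Then $|\tilde\Phi(\vec C)|\ge\frac65|\Phi(\vec C)|$, unless $|C_1|=|C_s|=2$, in which case $|\tilde\Phi(\vec C)|\ge|\Phi(\vec C)|$.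
   Context: A $t$-star with centre $T$ ($T\subseteq[n]$, $|T|=t$) is the family of all $k$-subsets of $[n]$ containing $T$. $\mathrm{OPT}(r)$ is the maximum of $\prod_{i=1}^s m_i$ over all $s\ge0$ and positive integers $m_i$ with $\sum m_i=r$. $\mathfrak{C}$ is the set of ordered partitions $\vec C=(C_1,\dots,C_s)$ of $\{1,\dots,r\}$ into $s$ parts with $\prod_i|C_i|=\mathrm{OPT}(r)$. Given a union $\mathcal{G}=\mathcal{J}_1\cup\dots\cup\mathcal{J}_s$ of the listed stars, the colourings corresponding to $\vec C$ are the maps $\varphi:\mathcal{G}\to\{1,\dots,r\}$ with $\varphi(F)\in\bigcup_{i:F\in\mathcal{J}_i}C_i$ for every $F\in\mathcal{G}$ (for $\tilde{\mathcal{F}}$, the $s$-th star is $\tilde{\mathcal{I}}_s$). -}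

module Defs where

open import Data.Nat using (ℕ; zero; suc; _+_; _*_; _≤_; _<_)
open import Data.Bool using (true; false)
open import Data.Fin using (Fin; zero; suc; fromℕ; _≟_)
open import Data.Fin.Subset using (Subset; _⊆_; ∣_∣; inside; outside)
open import Data.Fin.Subset.Properties using (_⊆?_)
open import Data.Fin.Properties using (any?)
open import Data.List using (List; []; _∷_; map; concatMap; filter; length; allFin)
open import Data.Nat.ListAction using (sum; product)
open import Data.List.Relation.Unary.All using (All)
open import Data.List.Relation.Binary.Pointwise using (Pointwise)
open import Data.List.Relation.Binary.Pointwise.Properties using (decidable)
open import Data.Vec using ([]; _∷_)
open import Data.Product using (Σ; ∃; _×_; _,_)
open import Relation.Binary.PropositionalEquality using (_≡_)
open import Relation.Nullary using (Dec; yes; no; ¬_)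
open import Relation.Nullary.Decidable using (_×-dec_)
import Data.Nat as ℕ

allSubsets : ∀ n → List (Subset n)
allSubsets zero = [] ∷ []
allSubsets (suc n) = concatMap (λ p → (outside ∷ p) ∷ (inside ∷ p) ∷ []) (allSubsets n)

kSubsets : ∀ n k → List (Subset n)
kSubsets n k = filter (λ F → ∣ F ∣ ℕ.≟ k) (allSubsets n)

starUnion : ∀ {n s} (k : ℕ) → (Fin s → Subset n) → List (Subset n)
starUnion {n} k T = filter (λ F → any? (λ i → T i ⊆? F)) (kSubsets n k)

IsOPT : ℕ → ℕ → Set
IsOPT r m =
  (Σ (List ℕ) λ ms → All (1 ≤_) ms × sum ms ≡ r × product ms ≡ m)
  × (∀ ms → All (1 ≤_) ms → sum ms ≡ r → product ms ≤ m)

-- An ordered partition (C_1,…,C_s) of the colour set [r] = Fin r into s parts,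
-- encoded by the map sending each colour c to the index i of the part C_i ∋ c.
-- |C_i| :
partSize : ∀ {r s} → (Fin r → Fin s) → Fin s → ℕ
partSize {r} C i = length (filter (λ c → C c ≟ i) (allFin r))

InFrakC : ∀ r s → (Fin r → Fin s) → Set
InFrakC r s C =
  (∀ i → 1 ≤ partSize C i)
  × (∀ opt → IsOPT r opt → product (map (partSize C) (allFin s)) ≡ opt)

allColourLists : ∀ (r m : ℕ) → List (List (Fin r))
allColourLists r zero = [] ∷ []
allColourLists r (suc m) = concatMap (λ c → map (c ∷_) (allColourLists r m)) (allFin r)

Allowed : ∀ {n r s} → (Fin s → Subset n) → (Fin r → Fin s) → Subset n → Fin r → Set
Allowed T C F c = ∃ λ i → T i ⊆ F × C c ≡ i

allowed? : ∀ {n r s} (T : Fin s → Subset n) (C : Fin r → Fin s) F c → Dec (Allowed T C F c)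
allowed? T C F c = any? (λ i → (T i ⊆? F) ×-dec (C c ≟ i))

-- Number of colourings of the union of the stars with centres T corresponding to C:
-- maps φ : starUnion k T → [r] (represented as colour lists aligned with starUnion k T)
-- with φ(F) ∈ ⋃_{i : F ∈ J_i} C_i for every F.
numColourings : ∀ {n r s} (k : ℕ) → (Fin s → Subset n) → (Fin r → Fin s) → ℕ
numColourings {r = r} k T C =
  length (filter (λ φ → decidable (allowed? T C) (starUnion k T) φ)
                 (allColourLists r (length (starUnion k T))))

replaceLast : ∀ {n m} → (Fin (suc m) → Subset n) → Subset n → Fin (suc m) → Subset n
replaceLast {m = m} T T̃ i with i ≟ fromℕ m
... | yes _ = T̃
... | no _ = T i

-- The number of colourings of a union of stars is ∏_F max(1, w F) over the k-sets F, where the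
-- weight w F counts the colours whose part has its centre inside F. Replacing T_s by T̃_s only moves
-- the |C_s| colours of the last part. Swap T_s and T̃_s by a bijection of [n] fixing all other points;
-- it induces a size-preserving involution σ on k-sets pairing each F ⊇ T_s with F ⊉ T̃_s to σ F.
-- If a F is the weight coming from the other parts, then a (σ F) ≤ a F, and such a pair contributes
-- (a F + |C_s|)·a (σ F) before and a F·(a (σ F) + |C_s|) after the replacement (reading 0 as 1);
-- this cannot decrease because in an optimal partition every part has at least two colours.
-- For the 6/5 gain take F₀ = T_1 ∪ T_s ∪ R with R disjoint from all centres: no centre lies in σ F₀,
-- a F₀ ≥ |C_1|, and the pair at F₀ gains the factor bc/(b+c) ≥ 6/5 for b, c ≥ 2 not both equal to 2.

module Submission where

open import Defs
open import Data.Bool using (Bool; true; false; _∧_; _∨_; not; if_then_else_)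
open import Data.Bool.Properties using (∧-identityʳ; ∧-zeroʳ)
open import Data.Nat using (ℕ; zero; suc; _+_; _*_; _∸_; _≤_; _<_; _⊔_; _/_; _%_; z≤n; s≤s)
  renaming (_≟_ to _≟ℕ_)
open import Data.Nat.Properties hiding (_≟_)
open import Algebra.Properties.CommutativeSemigroup *-commutativeSemigroup using (interchange; x∙yz≈y∙xz)
open import Data.Nat.DivMod using (m≡m%n+[m/n]*n; m/n*n≤m; /-monoˡ-≤)
open import Data.Nat.ListAction using (sum; product)
open import Data.Nat.ListAction.Properties using (sum-↭; product-↭)
open import Data.List using (List; []; _∷_; map; filter; length; concatMap; allFin)
open import Data.List.Properties using (length-++; length-map; filter-++; map-cong; map-∘; map-tabulate; length-tabulate)
open import Data.List.Membership.Propositional using () renaming (_∈_ to _∈ₗ_)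
open import Data.List.Membership.Propositional.Properties using (∈-map⁺; ∈-map⁻; ∈-filter⁺; ∈-filter⁻; ∈-allFin; ∈-∃++)
open import Data.List.Membership.Propositional.Properties.WithK using (unique∧set⇒bag)
open import Data.List.Relation.Binary.BagAndSetEquality using (∼bag⇒↭)
open import Data.List.Relation.Binary.Permutation.Propositional using (_↭_)
import Data.List.Relation.Binary.Permutation.Propositional.Properties as ↭
open import Data.List.Relation.Binary.Pointwise.Properties using (decidable)
open import Data.List.Relation.Unary.Any using (here; there)
open import Data.List.Relation.Unary.Unique.Propositional using (Unique)
open import Data.List.Relation.Unary.Unique.Propositional.Properties using (allFin⁺)
open import Data.List.Relation.Unary.AllPairs using ([]; _∷_)
open import Data.List.Relation.Unary.All using (All; []; _∷_)
import Data.List.Relation.Unary.All as All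
import Data.List.Relation.Unary.All.Properties as All
import Data.List.Relation.Unary.Unique.Propositional.Properties as Unique
open import Data.Fin using (Fin; zero; suc; fromℕ; _≟_)
import Data.Fin as Fin
open import Data.Fin.Properties using (any?)
open import Data.Fin.Permutation.Components using (transpose)
open import Data.Fin.Subset using (Subset; ∣_∣; _∩_; _∪_; _∈_; _∉_; _⊆_; ⋃; ∁; Nonempty; inside; outside)
  renaming (⊥ to ∅)
open import Data.Fin.Subset.Properties
  using (_⊆?_; _∈?_; ⊥⊆; ∣∁p∣≡n∸∣p∣; x∈∁p⇒x∉p; x∈p∪q⁻; p⊂q⇒∣p∣<∣q∣; ∣⊥∣≡0; Empty-unique; x∈p∩q⁻; x∈p⇒∣p-x∣<∣p∣; p⊆p∪q; q⊆p∪q; in⊆in; out⊆)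
open import Data.Vec using (_∷_; []; here; there; lookup; tabulate; _[_]≔_)
open import Data.Vec.Properties using ([]=⇒lookup; lookup⇒[]=; lookup∘tabulate; tabulate∘lookup; tabulate-cong)
open import Data.Product using (∃; ∃-syntax; _×_; _,_; proj₁; proj₂)
open import Data.Sum using (_⊎_; inj₁; inj₂; [_,_]′)
open import Function.Base using (_∘_)
open import Data.Nat.Tactic.RingSolver using (solve-∀)
open import Function.Bundles using (mk⇔)
open import Relation.Binary.PropositionalEquality
open import Relation.Nullary using (Dec; yes; no; ¬_; does; contradiction)
open import Relation.Nullary.Decidable using (T?; dec-true; dec-false; does-⇔)

countᵇ : ∀ {a} {A : Set a} → (A → Bool) → List A → ℕ
countᵇ p [] = 0
countᵇ p (x ∷ xs) = if p x then suc (countᵇ p xs) else countᵇ p xs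

∏ : ∀ {a} {A : Set a} → (A → ℕ) → List A → ℕ
∏ f xs = product (map f xs)

module _ {a} {A : Set a} where

  length-filter≡countᵇ : ∀ {p} {P : A → Set p} (P? : ∀ x → Dec (P x)) xs →
    length (filter P? xs) ≡ countᵇ (λ x → does (P? x)) xs
  length-filter≡countᵇ P? [] = refl
  length-filter≡countᵇ P? (x ∷ xs) with does (P? x)
  ... | true = cong suc (length-filter≡countᵇ P? xs)
  ... | false = length-filter≡countᵇ P? xs

  countᵇ-cong : ∀ {p q : A → Bool} xs → (∀ x → p x ≡ q x) → countᵇ p xs ≡ countᵇ q xs
  countᵇ-cong [] _ = refl
  countᵇ-cong {p} {q} (x ∷ xs) p≗q rewrite p≗q x with q x
  ... | true = cong suc (countᵇ-cong xs p≗q)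
  ... | false = countᵇ-cong xs p≗q

  countᵇ-mono : ∀ {p q : A → Bool} xs → (∀ x → p x ≡ true → q x ≡ true) →
    countᵇ p xs ≤ countᵇ q xs
  countᵇ-mono [] _ = z≤n
  countᵇ-mono {p} {q} (x ∷ xs) p⇒q with p x in px | q x in qx
  ... | true | true = s≤s (countᵇ-mono xs p⇒q)
  ... | true | false with () ← trans (sym (p⇒q x px)) qx
  ... | false | true = m≤n⇒m≤1+n (countᵇ-mono xs p⇒q)
  ... | false | false = countᵇ-mono xs p⇒q

  countᵇ-none : ∀ {p : A → Bool} xs → (∀ x → p x ≡ false) → countᵇ p xs ≡ 0
  countᵇ-none [] _ = refl
  countᵇ-none (x ∷ xs) none rewrite none x = countᵇ-none xs none

  countᵇ-pos : ∀ {p : A → Bool} {x} xs → x ∈ₗ xs → p x ≡ true → 0 < countᵇ p xs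
  countᵇ-pos {p} (y ∷ xs) (here refl) px rewrite px = s≤s z≤n
  countᵇ-pos {p} (y ∷ xs) (there x∈xs) px with p y
  ... | true = s≤s z≤n
  ... | false = countᵇ-pos xs x∈xs px

  countᵇ-pos⁻ : ∀ {p : A → Bool} xs → 0 < countᵇ p xs → ∃[ x ] x ∈ₗ xs × p x ≡ true
  countᵇ-pos⁻ {p} (x ∷ xs) pos with p x in px
  ... | true = x , here refl , px
  ... | false with y , y∈xs , py ← countᵇ-pos⁻ xs pos = y , there y∈xs , py

  countᵇ-split : ∀ (q p : A → Bool) xs →
    countᵇ p xs ≡ countᵇ (λ x → not (q x) ∧ p x) xs + countᵇ (λ x → q x ∧ p x) xs
  countᵇ-split q p [] = refl
  countᵇ-split q p (x ∷ xs) with q x | p x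
  ... | true | true = trans (cong suc (countᵇ-split q p xs)) (sym (+-suc _ _))
  ... | false | true = cong suc (countᵇ-split q p xs)
  ... | true | false = countᵇ-split q p xs
  ... | false | false = countᵇ-split q p xs

  countᵇ-∧-const : ∀ (q : A → Bool) (b : Bool) xs →
    countᵇ (λ x → q x ∧ b) xs ≡ (if b then countᵇ q xs else 0)
  countᵇ-∧-const q true xs = countᵇ-cong xs (λ x → ∧-identityʳ (q x))
  countᵇ-∧-const q false xs = countᵇ-none xs (λ x → ∧-zeroʳ (q x))

  countᵇ-map : ∀ {b} {B : Set b} (p : B → Bool) (f : A → B) xs →
    countᵇ p (map f xs) ≡ countᵇ (λ x → p (f x)) xs
  countᵇ-map p f [] = refl
  countᵇ-map p f (x ∷ xs) with p (f x)
  ... | true = cong suc (countᵇ-map p f xs)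
  ... | false = countᵇ-map p f xs

  countᵇ-↭ : ∀ (p : A → Bool) {xs ys} → xs ↭ ys → countᵇ p xs ≡ countᵇ p ys
  countᵇ-↭ p {xs} {ys} xs↭ys = begin
    countᵇ p xs                                 ≡⟨ sym (length-filter≡countᵇ (λ x → T? (p x)) xs) ⟩
    length (filter (λ x → T? (p x)) xs)        ≡⟨ ↭.↭-length (↭.filter-↭ (λ x → T? (p x)) xs↭ys) ⟩
    length (filter (λ x → T? (p x)) ys)        ≡⟨ length-filter≡countᵇ (λ x → T? (p x)) ys ⟩
    countᵇ p ys                                 ∎
    where open ≡-Reasoning

  ∏-cong : ∀ {f g : A → ℕ} xs → (∀ x → f x ≡ g x) → ∏ f xs ≡ ∏ g xs
  ∏-cong xs f≗g = cong product (map-cong f≗g xs)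

  ∏-* : ∀ (f g : A → ℕ) xs → ∏ (λ x → f x * g x) xs ≡ ∏ f xs * ∏ g xs
  ∏-* f g [] = refl
  ∏-* f g (x ∷ xs) = begin
    f x * g x * ∏ (λ x → f x * g x) xs  ≡⟨ cong (f x * g x *_) (∏-* f g xs) ⟩
    f x * g x * (∏ f xs * ∏ g xs)       ≡⟨ interchange (f x) (g x) (∏ f xs) (∏ g xs) ⟩
    f x * ∏ f xs * (g x * ∏ g xs)       ∎
    where open ≡-Reasoning

  ∏-↭ : ∀ (f : A → ℕ) {xs ys} → xs ↭ ys → ∏ f xs ≡ ∏ f ys
  ∏-↭ f xs↭ys = product-↭ (↭.map⁺ f xs↭ys)

  ∏-filter : ∀ {p} {P : A → Set p} (P? : ∀ x → Dec (P x)) (f : A → ℕ) xs →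
    ∏ f (filter P? xs) ≡ ∏ (λ x → if does (P? x) then f x else 1) xs
  ∏-filter P? f [] = refl
  ∏-filter P? f (x ∷ xs) with does (P? x)
  ... | true = cong (f x *_) (∏-filter P? f xs)
  ... | false = trans (∏-filter P? f xs) (sym (+-identityʳ _))

  ∏-mono-≤ : ∀ {f g : A → ℕ} xs → (∀ x → f x ≤ g x) → ∏ f xs ≤ ∏ g xs
  ∏-mono-≤ [] _ = ≤-refl
  ∏-mono-≤ (x ∷ xs) f≤g = *-mono-≤ (f≤g x) (∏-mono-≤ xs f≤g)

  ∏-mono-ratio : ∀ {f g : A → ℕ} {x₀} a b xs → x₀ ∈ₗ xs → (∀ x → f x ≤ g x) →
    a * f x₀ ≤ b * g x₀ → a * ∏ f xs ≤ b * ∏ g xs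
  ∏-mono-ratio {f} {g} a b (x ∷ xs) (here refl) f≤g gain = begin
    a * (f x * ∏ f xs)  ≡⟨ *-assoc a (f x) _ ⟨
    a * f x * ∏ f xs    ≤⟨ *-mono-≤ gain (∏-mono-≤ xs f≤g) ⟩
    b * g x * ∏ g xs    ≡⟨ *-assoc b (g x) _ ⟩
    b * (g x * ∏ g xs)  ∎
    where open ≤-Reasoning
  ∏-mono-ratio {f} {g} a b (x ∷ xs) (there x₀∈xs) f≤g gain = begin
    a * (f x * ∏ f xs)  ≡⟨ x∙yz≈y∙xz a (f x) _ ⟩
    f x * (a * ∏ f xs)  ≤⟨ *-mono-≤ (f≤g x) (∏-mono-ratio a b xs x₀∈xs f≤g gain) ⟩
    g x * (b * ∏ g xs)  ≡⟨ x∙yz≈y∙xz (g x) b _ ⟩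
    b * (g x * ∏ g xs)  ∎
    where open ≤-Reasoning

module _ {a} {A : Set a} {σ : A → A} (σ-involutive : ∀ x → σ (σ x) ≡ x) where

  map-involution-↭ : ∀ {xs} → Unique xs → (∀ {x} → x ∈ₗ xs → σ x ∈ₗ xs) → map σ xs ↭ xs
  map-involution-↭ {xs} xs-unique σ-closed =
    ∼bag⇒↭ (unique∧set⇒bag (Unique.map⁺ σ-injective xs-unique) xs-unique (mk⇔ to from))
    where
      σ-injective : ∀ {x y} → σ x ≡ σ y → x ≡ y
      σ-injective {x} {y} eq = trans (sym (σ-involutive x)) (trans (cong σ eq) (σ-involutive y))
      to : ∀ {y} → y ∈ₗ map σ xs → y ∈ₗ xs
      to y∈ with x , x∈xs , refl ← ∈-map⁻ σ y∈ = σ-closed x∈xs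
      from : ∀ {y} → y ∈ₗ xs → y ∈ₗ map σ xs
      from {y} y∈xs = subst (_∈ₗ map σ xs) (σ-involutive y) (∈-map⁺ σ (σ-closed y∈xs))

  ∏-involution : ∀ (f : A → ℕ) {xs} → Unique xs → (∀ {x} → x ∈ₗ xs → σ x ∈ₗ xs) →
    ∏ f xs ≡ ∏ (λ x → f (σ x)) xs
  ∏-involution f {xs} xs-unique σ-closed =
    trans (sym (∏-↭ f (map-involution-↭ xs-unique σ-closed))) (cong product (sym (map-∘ xs)))

  module _ (X : A → Bool) (X-σ : ∀ x → X x ≡ true → X (σ x) ≡ false) where

    -- The factor of x ∈ X absorbs that of its partner σ x ∉ X.
    pairUp : (A → ℕ) → A → ℕ
    pairUp f x = if X x then f x * f (σ x) else if X (σ x) then 1 else f x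

    ∏-pairUp : ∀ (f : A → ℕ) {xs} → Unique xs → (∀ {x} → x ∈ₗ xs → σ x ∈ₗ xs) →
      ∏ f xs ≡ ∏ (pairUp f) xs
    ∏-pairUp f {xs} xs-unique σ-closed = begin
      ∏ f xs                                      ≡⟨ ∏-cong xs split ⟩
      ∏ (λ x → inX x * (inσX x * rest x)) xs      ≡⟨ ∏-* inX _ xs ⟩
      ∏ inX xs * ∏ (λ x → inσX x * rest x) xs     ≡⟨ cong (∏ inX xs *_) (∏-* inσX rest xs) ⟩
      ∏ inX xs * (∏ inσX xs * ∏ rest xs)          ≡⟨ cong (λ y → ∏ inX xs * (y * ∏ rest xs)) moveσ ⟩
      ∏ inX xs * (∏ partner xs * ∏ rest xs)       ≡⟨ cong (∏ inX xs *_) (∏-* partner rest xs) ⟨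
      ∏ inX xs * ∏ (λ x → partner x * rest x) xs  ≡⟨ ∏-* inX _ xs ⟨
      ∏ (λ x → inX x * (partner x * rest x)) xs   ≡⟨ ∏-cong xs merge ⟩
      ∏ (pairUp f) xs                             ∎
      where
        open ≡-Reasoning
        inX inσX partner rest : A → ℕ
        inX x = if X x then f x else 1
        inσX x = if X (σ x) then f x else 1
        partner x = if X x then f (σ x) else 1
        rest x = if X x ∨ X (σ x) then 1 else f x

        split : ∀ x → f x ≡ inX x * (inσX x * rest x)
        split x with X x in Xx | X (σ x) in Xσx
        ... | true | true with () ← trans (sym (X-σ x Xx)) Xσx
        ... | true | false = sym (*-identityʳ (f x))
        ... | false | true = sym (trans (+-identityʳ _) (*-identityʳ (f x)))
        ... | false | false = sym (trans (+-identityʳ _) (+-identityʳ (f x)))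

        moveσ : ∏ inσX xs ≡ ∏ partner xs
        moveσ = trans (∏-involution inσX xs-unique σ-closed)
                      (∏-cong xs (λ x → cong (λ y → if X y then f (σ x) else 1) (σ-involutive x)))

        merge : ∀ x → inX x * (partner x * rest x) ≡ pairUp f x
        merge x with X x in Xx | X (σ x)
        ... | true | _ = cong (f x *_) (*-identityʳ (f (σ x)))
        ... | false | true = refl
        ... | false | false = trans (+-identityʳ _) (+-identityʳ (f x))

module _ {A : Set} {r} {R : A → Fin r → Set} (R? : ∀ x c → Dec (R x c)) where

  choices : A → ℕ
  choices x = countᵇ (λ c → does (R? x c)) (allFin r)

  private
    admissible : ∀ L → List (List (Fin r)) → ℕ
    admissible L Φ = length (filter (decidable R? L) Φ)

    admissible-prefix : ∀ x L c Φ →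
      admissible (x ∷ L) (map (c ∷_) Φ) ≡ (if does (R? x c) then admissible L Φ else 0)
    admissible-prefix x L c [] with does (R? x c)
    ... | true = refl
    ... | false = refl
    admissible-prefix x L c (φ ∷ Φ) with does (R? x c) | does (decidable R? L φ)
                                    | admissible-prefix x L c Φ
    ... | true | true | ih = cong suc ih
    ... | true | false | ih = ih
    ... | false | _ | ih = ih

    admissible-prefixes : ∀ x L cs Φ →
      admissible (x ∷ L) (concatMap (λ c → map (c ∷_) Φ) cs)
        ≡ countᵇ (λ c → does (R? x c)) cs * admissible L Φ
    admissible-prefixes x L [] Φ = refl
    admissible-prefixes x L (c ∷ cs) Φ
      rewrite filter-++ (decidable R? (x ∷ L)) (map (c ∷_) Φ) (concatMap (λ c → map (c ∷_) Φ) cs)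
            | length-++ (filter (decidable R? (x ∷ L)) (map (c ∷_) Φ))
                        {filter (decidable R? (x ∷ L)) (concatMap (λ c → map (c ∷_) Φ) cs)}
            | admissible-prefix x L c Φ
            | admissible-prefixes x L cs Φ
      with does (R? x c)
    ... | true = refl
    ... | false = refl

  admissible-colourings : ∀ L → length (filter (decidable R? L) (allColourLists r (length L))) ≡ ∏ choices L
  admissible-colourings [] = refl
  admissible-colourings (x ∷ L) =
    trans (admissible-prefixes x L (allFin r) (allColourLists r (length L)))
          (cong (choices x *_) (admissible-colourings L))

_⊆ᵇ_ : ∀ {n} → Subset n → Subset n → Bool
P ⊆ᵇ F = does (P ⊆? F)

⊆ᵇ⇒⊆ : ∀ {n} {P F : Subset n} → P ⊆ᵇ F ≡ true → P ⊆ F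
⊆ᵇ⇒⊆ {P = P} {F} P⊆ᵇF with P ⊆? F
... | yes P⊆F = P⊆F

countᵇ-allFin-suc : ∀ {n} (p : Fin (suc n) → Bool) → countᵇ p (allFin (suc n)) ≡
  (if p zero then suc (countᵇ (λ i → p (suc i)) (allFin n)) else countᵇ (λ i → p (suc i)) (allFin n))
countᵇ-allFin-suc {n} p =
  trans (cong (λ is → countᵇ p (zero ∷ is)) (sym (map-tabulate {n = n} (λ i → i) Fin.suc)))
        (cong (λ c → if p zero then suc c else c) (countᵇ-map p Fin.suc (allFin n)))

∣p∣≡countᵇ-lookup : ∀ {n} (p : Subset n) → ∣ p ∣ ≡ countᵇ (lookup p) (allFin n)
∣p∣≡countᵇ-lookup [] = refl
∣p∣≡countᵇ-lookup (inside ∷ p) = trans (cong suc (∣p∣≡countᵇ-lookup p)) (sym (countᵇ-allFin-suc (lookup (inside ∷ p))))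
∣p∣≡countᵇ-lookup (outside ∷ p) = trans (∣p∣≡countᵇ-lookup p) (sym (countᵇ-allFin-suc (lookup (outside ∷ p))))

∣p∣>0⇒Nonempty : ∀ {n} (p : Subset n) → 0 < ∣ p ∣ → Nonempty p
∣p∣>0⇒Nonempty (inside ∷ p) _ = zero , here
∣p∣>0⇒Nonempty (outside ∷ p) pos with x , x∈p ← ∣p∣>0⇒Nonempty p pos = suc x , there x∈p

x∈p⇒∣p∣>0 : ∀ {n} {p : Subset n} {x} → x ∈ p → 0 < ∣ p ∣
x∈p⇒∣p∣>0 x∈p = ≤-<-trans z≤n (x∈p⇒∣p-x∣<∣p∣ x∈p)

∣p∪q∣+∣p∩q∣≡∣p∣+∣q∣ : ∀ {n} (p q : Subset n) → ∣ p ∪ q ∣ + ∣ p ∩ q ∣ ≡ ∣ p ∣ + ∣ q ∣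
∣p∪q∣+∣p∩q∣≡∣p∣+∣q∣ [] [] = refl
∣p∪q∣+∣p∩q∣≡∣p∣+∣q∣ (inside ∷ p) (inside ∷ q) =
  trans (cong suc (+-suc ∣ p ∪ q ∣ ∣ p ∩ q ∣))
        (trans (cong (λ x → suc (suc x)) (∣p∪q∣+∣p∩q∣≡∣p∣+∣q∣ p q)) (cong suc (sym (+-suc ∣ p ∣ ∣ q ∣))))
∣p∪q∣+∣p∩q∣≡∣p∣+∣q∣ (inside ∷ p) (outside ∷ q) = cong suc (∣p∪q∣+∣p∩q∣≡∣p∣+∣q∣ p q)
∣p∪q∣+∣p∩q∣≡∣p∣+∣q∣ (outside ∷ p) (inside ∷ q) =
  trans (cong suc (∣p∪q∣+∣p∩q∣≡∣p∣+∣q∣ p q)) (sym (+-suc ∣ p ∣ ∣ q ∣))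
∣p∪q∣+∣p∩q∣≡∣p∣+∣q∣ (outside ∷ p) (outside ∷ q) = ∣p∪q∣+∣p∩q∣≡∣p∣+∣q∣ p q

∣p∪q∣≤∣p∣+∣q∣ : ∀ {n} (p q : Subset n) → ∣ p ∪ q ∣ ≤ ∣ p ∣ + ∣ q ∣
∣p∪q∣≤∣p∣+∣q∣ p q = subst (∣ p ∪ q ∣ ≤_) (∣p∪q∣+∣p∩q∣≡∣p∣+∣q∣ p q) (m≤m+n _ _)

disjoint⇒∣p∪q∣≡∣p∣+∣q∣ : ∀ {n} (p q : Subset n) → (∀ {x} → x ∈ p → x ∉ q) → ∣ p ∪ q ∣ ≡ ∣ p ∣ + ∣ q ∣
disjoint⇒∣p∪q∣≡∣p∣+∣q∣ {n} p q disjoint = begin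
  ∣ p ∪ q ∣                  ≡⟨ +-identityʳ _ ⟨
  ∣ p ∪ q ∣ + 0              ≡⟨ cong (∣ p ∪ q ∣ +_) (∣⊥∣≡0 n) ⟨
  ∣ p ∪ q ∣ + ∣ ∅ {n} ∣      ≡⟨ cong (λ z → ∣ p ∪ q ∣ + ∣ z ∣) p∩q≡∅ ⟨
  ∣ p ∪ q ∣ + ∣ p ∩ q ∣      ≡⟨ ∣p∪q∣+∣p∩q∣≡∣p∣+∣q∣ p q ⟩
  ∣ p ∣ + ∣ q ∣              ∎
  where
    open ≡-Reasoning
    p∩q≡∅ : p ∩ q ≡ ∅ {n}
    p∩q≡∅ = Empty-unique λ (x , x∈p∩q) → let x∈p , x∈q = x∈p∩q⁻ p q x∈p∩q in disjoint x∈p x∈q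

p∈ps⇒p⊆⋃ps : ∀ {n} {p : Subset n} {ps} → p ∈ₗ ps → p ⊆ ⋃ ps
p∈ps⇒p⊆⋃ps {ps = q ∷ ps} (here refl) = p⊆p∪q (⋃ ps)
p∈ps⇒p⊆⋃ps {ps = q ∷ ps} (there p∈ps) = q⊆p∪q q (⋃ ps) ∘ p∈ps⇒p⊆⋃ps p∈ps

∣⋃ps∣≤ : ∀ {n} t (ps : List (Subset n)) → (∀ {p} → p ∈ₗ ps → ∣ p ∣ ≤ t) → ∣ ⋃ ps ∣ ≤ length ps * t
∣⋃ps∣≤ {n} t [] _ = ≤-reflexive (∣⊥∣≡0 n)
∣⋃ps∣≤ t (p ∷ ps) ∣ps∣≤t = begin
  ∣ p ∪ ⋃ ps ∣          ≤⟨ ∣p∪q∣≤∣p∣+∣q∣ p (⋃ ps) ⟩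
  ∣ p ∣ + ∣ ⋃ ps ∣      ≤⟨ +-mono-≤ (∣ps∣≤t (here refl)) (∣⋃ps∣≤ t ps (∣ps∣≤t ∘ there)) ⟩
  t + length ps * t     ∎
  where open ≤-Reasoning

x∉p[x]≔outside : ∀ {n} (p : Subset n) x → x ∉ p [ x ]≔ outside
x∉p[x]≔outside (b ∷ p) (suc x) (there x∈) = x∉p[x]≔outside p x x∈

∈-p[x]≔outside⁺ : ∀ {n} {p : Subset n} {x y} → y ∈ p → y ≢ x → y ∈ p [ x ]≔ outside
∈-p[x]≔outside⁺ {x = zero} {y = zero} here y≢x = contradiction refl y≢x
∈-p[x]≔outside⁺ {x = suc x} {y = zero} here _ = here
∈-p[x]≔outside⁺ {x = zero} {y = suc y} (there y∈p) _ = there y∈p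
∈-p[x]≔outside⁺ {x = suc x} {y = suc y} (there y∈p) y≢x = there (∈-p[x]≔outside⁺ y∈p (y≢x ∘ cong suc))

∈-p[x]≔outside⁻ : ∀ {n} {p : Subset n} {x y} → y ∈ p [ x ]≔ outside → y ∈ p
∈-p[x]≔outside⁻ {p = b ∷ p} {zero} {suc y} (there y∈) = there y∈
∈-p[x]≔outside⁻ {p = b ∷ p} {suc x} {zero} here = here
∈-p[x]≔outside⁻ {p = b ∷ p} {suc x} {suc y} (there y∈) = there (∈-p[x]≔outside⁻ y∈)

∣p[x]≔outside∣ : ∀ {n} {p : Subset n} {x} → x ∈ p → suc ∣ p [ x ]≔ outside ∣ ≡ ∣ p ∣
∣p[x]≔outside∣ {p = inside ∷ p} {zero} here = refl
∣p[x]≔outside∣ {p = inside ∷ p} {suc x} (there x∈p) = cong suc (∣p[x]≔outside∣ x∈p)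
∣p[x]≔outside∣ {p = outside ∷ p} {suc x} (there x∈p) = ∣p[x]≔outside∣ x∈p

∃-⊆-of-size : ∀ {n} (p : Subset n) {j} → j ≤ ∣ p ∣ → ∃[ q ] q ⊆ p × ∣ q ∣ ≡ j
∃-⊆-of-size {n} p {zero} _ = ∅ , ⊥⊆ , ∣⊥∣≡0 n
∃-⊆-of-size (inside ∷ p) {suc j} (s≤s j≤∣p∣) with q , q⊆p , ∣q∣≡j ← ∃-⊆-of-size p j≤∣p∣ =
  inside ∷ q , in⊆in q⊆p , cong suc ∣q∣≡j
∃-⊆-of-size (outside ∷ p) {suc j} j≤∣p∣ with q , q⊆p , ∣q∣≡j ← ∃-⊆-of-size p j≤∣p∣ =
  outside ∷ q , out⊆ q⊆p , ∣q∣≡j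

private
  extensions : ∀ {n} → List (Subset n) → List (Subset (suc n))
  extensions = concatMap (λ p → (outside ∷ p) ∷ (inside ∷ p) ∷ [])

  ∈-extensions⁺ : ∀ {n} b {p : Subset n} ps → p ∈ₗ ps → (b ∷ p) ∈ₗ extensions ps
  ∈-extensions⁺ outside (q ∷ ps) (here refl) = here refl
  ∈-extensions⁺ inside (q ∷ ps) (here refl) = there (here refl)
  ∈-extensions⁺ b (q ∷ ps) (there p∈ps) = there (there (∈-extensions⁺ b ps p∈ps))

  ∈-extensions⁻ : ∀ {n} b {p : Subset n} ps → (b ∷ p) ∈ₗ extensions ps → p ∈ₗ ps
  ∈-extensions⁻ b (q ∷ ps) (here refl) = here refl
  ∈-extensions⁻ b (q ∷ ps) (there (here refl)) = here refl
  ∈-extensions⁻ b (q ∷ ps) (there (there bp∈)) = there (∈-extensions⁻ b ps bp∈)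

  extensions-unique : ∀ {n} {ps : List (Subset n)} → Unique ps → Unique (extensions ps)
  extensions-unique {ps = []} _ = []
  extensions-unique {ps = p ∷ ps} (p∉ps ∷ ps-unique) =
    ((λ ()) ∷ All.tabulate (fresh outside)) ∷ All.tabulate (fresh inside) ∷ extensions-unique ps-unique
    where
      fresh : ∀ b {q} → q ∈ₗ extensions ps → b ∷ p ≢ q
      fresh b q∈ refl = All.lookup p∉ps (∈-extensions⁻ b ps q∈) refl

∈-allSubsets : ∀ {n} (p : Subset n) → p ∈ₗ allSubsets n
∈-allSubsets [] = here refl
∈-allSubsets (b ∷ p) = ∈-extensions⁺ b _ (∈-allSubsets p)

allSubsets-unique : ∀ n → Unique (allSubsets n)
allSubsets-unique zero = [] ∷ []
allSubsets-unique (suc n) = extensions-unique (allSubsets-unique n)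

∈-kSubsets⁺ : ∀ {n k} {p : Subset n} → ∣ p ∣ ≡ k → p ∈ₗ kSubsets n k
∈-kSubsets⁺ {k = k} {p} ∣p∣≡k = ∈-filter⁺ (λ F → ∣ F ∣ ≟ℕ k) (∈-allSubsets p) ∣p∣≡k

∈-kSubsets⁻ : ∀ {n k} {p : Subset n} → p ∈ₗ kSubsets n k → ∣ p ∣ ≡ k
∈-kSubsets⁻ {n} {k} p∈ = proj₂ (∈-filter⁻ (λ F → ∣ F ∣ ≟ℕ k) {xs = allSubsets n} p∈)

kSubsets-unique : ∀ n k → Unique (kSubsets n k)
kSubsets-unique n k = Unique.filter⁺ (λ F → ∣ F ∣ ≟ℕ k) {allSubsets n} (allSubsets-unique n)

-- Exchanging two disjoint sets of equal size

transpose-matchˡ : ∀ {n} (i j : Fin n) → transpose i j i ≡ j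
transpose-matchˡ i j rewrite dec-true (i ≟ i) refl = refl

transpose-matchʳ : ∀ {n} (i j : Fin n) → transpose i j j ≡ i
transpose-matchʳ i j with j ≟ i
... | yes j≡i = j≡i
... | no _ rewrite dec-true (j ≟ j) refl = refl

transpose-other : ∀ {n} {i j k : Fin n} → k ≢ i → k ≢ j → transpose i j k ≡ k
transpose-other {i = i} {j} {k} k≢i k≢j rewrite dec-false (k ≟ i) k≢i | dec-false (k ≟ j) k≢j = refl

record Exchanges {n} (P Q : Subset n) (ρ : Fin n → Fin n) : Set where
  field
    involutive : ∀ x → ρ (ρ x) ≡ x
    P→Q : ∀ {x} → x ∈ P → ρ x ∈ Q
    Q→P : ∀ {x} → x ∈ Q → ρ x ∈ P
    fixes : ∀ {x} → x ∉ P → x ∉ Q → ρ x ≡ x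

module _ {n} {P Q : Subset n} {x y : Fin n} (x∈P : x ∈ P) (y∈Q : y ∈ Q)
         (disjoint : ∀ {z} → z ∈ P → z ∉ Q)
         {ρ : Fin n → Fin n} (ρ-exchanges : Exchanges (P [ x ]≔ outside) (Q [ y ]≔ outside) ρ) where

  open Exchanges ρ-exchanges

  private
    τ : Fin n → Fin n
    τ = transpose x y

    ρx≡x : ρ x ≡ x
    ρx≡x = fixes (x∉p[x]≔outside P x) (λ x∈Q′ → disjoint x∈P (∈-p[x]≔outside⁻ x∈Q′))

    ρy≡y : ρ y ≡ y
    ρy≡y = fixes (λ y∈P′ → disjoint (∈-p[x]≔outside⁻ y∈P′) y∈Q) (x∉p[x]≔outside Q y)

    ρ-avoids : ∀ {z} → z ≢ x → z ≢ y → ρ z ≢ x × ρ z ≢ y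
    ρ-avoids {z} z≢x z≢y =
      (λ ρz≡x → z≢x (trans (sym (involutive z)) (trans (cong ρ ρz≡x) ρx≡x))) ,
      (λ ρz≡y → z≢y (trans (sym (involutive z)) (trans (cong ρ ρz≡y) ρy≡y)))

    τρ-other : ∀ {z} → z ≢ x → z ≢ y → τ (ρ z) ≡ ρ z
    τρ-other z≢x z≢y = let ρz≢x , ρz≢y = ρ-avoids z≢x z≢y in transpose-other ρz≢x ρz≢y

    τρx≡y : τ (ρ x) ≡ y
    τρx≡y = trans (cong τ ρx≡x) (transpose-matchˡ x y)

    τρy≡x : τ (ρ y) ≡ x
    τρy≡x = trans (cong τ ρy≡y) (transpose-matchʳ x y)

  extend-exchange : Exchanges P Q (λ z → τ (ρ z))
  extend-exchange = record { involutive = involutive′ ; P→Q = P→Q′ ; Q→P = Q→P′ ; fixes = fixes′ }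
    where
      involutive′ : ∀ z → τ (ρ (τ (ρ z))) ≡ z
      involutive′ z with z ≟ x | z ≟ y
      ... | yes refl | _ = trans (cong (τ ∘ ρ) τρx≡y) τρy≡x
      ... | no _ | yes refl = trans (cong (τ ∘ ρ) τρy≡x) τρx≡y
      ... | no z≢x | no z≢y =
        trans (cong (τ ∘ ρ) (τρ-other z≢x z≢y)) (trans (cong τ (involutive z)) (transpose-other z≢x z≢y))

      P→Q′ : ∀ {z} → z ∈ P → τ (ρ z) ∈ Q
      P→Q′ {z} z∈P with z ≟ x | z ≟ y
      ... | yes refl | _ = subst (_∈ Q) (sym τρx≡y) y∈Q
      ... | no _ | yes refl = contradiction y∈Q (disjoint z∈P)
      ... | no z≢x | no z≢y =
        subst (_∈ Q) (sym (τρ-other z≢x z≢y)) (∈-p[x]≔outside⁻ (P→Q (∈-p[x]≔outside⁺ z∈P z≢x)))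

      Q→P′ : ∀ {z} → z ∈ Q → τ (ρ z) ∈ P
      Q→P′ {z} z∈Q with z ≟ x | z ≟ y
      ... | yes refl | _ = contradiction z∈Q (disjoint x∈P)
      ... | no _ | yes refl = subst (_∈ P) (sym τρy≡x) x∈P
      ... | no z≢x | no z≢y =
        subst (_∈ P) (sym (τρ-other z≢x z≢y)) (∈-p[x]≔outside⁻ (Q→P (∈-p[x]≔outside⁺ z∈Q z≢y)))

      fixes′ : ∀ {z} → z ∉ P → z ∉ Q → τ (ρ z) ≡ z
      fixes′ {z} z∉P z∉Q =
        trans (τρ-other z≢x z≢y) (fixes (z∉P ∘ ∈-p[x]≔outside⁻) (z∉Q ∘ ∈-p[x]≔outside⁻))
        where
          z≢x : z ≢ x
          z≢x refl = z∉P x∈P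
          z≢y : z ≢ y
          z≢y refl = z∉Q y∈Q

∣p∣≡0⇒x∉p : ∀ {n} {p : Subset n} {x} → ∣ p ∣ ≡ 0 → x ∉ p
∣p∣≡0⇒x∉p ∣p∣≡0 x∈p with () ← subst (0 <_) ∣p∣≡0 (x∈p⇒∣p∣>0 x∈p)

exchange : ∀ {n} t {P Q : Subset n} → ∣ P ∣ ≡ t → ∣ Q ∣ ≡ t → (∀ {x} → x ∈ P → x ∉ Q) →
  ∃ (Exchanges P Q)
exchange zero ∣P∣≡0 ∣Q∣≡0 _ = (λ z → z) , record
  { involutive = λ _ → refl
  ; P→Q = λ x∈P → contradiction x∈P (∣p∣≡0⇒x∉p ∣P∣≡0)
  ; Q→P = λ x∈Q → contradiction x∈Q (∣p∣≡0⇒x∉p ∣Q∣≡0)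
  ; fixes = λ _ _ → refl
  }
exchange (suc t) {P} {Q} ∣P∣≡1+t ∣Q∣≡1+t disjoint
  with x , x∈P ← ∣p∣>0⇒Nonempty P (subst (0 <_) (sym ∣P∣≡1+t) (s≤s z≤n))
     | y , y∈Q ← ∣p∣>0⇒Nonempty Q (subst (0 <_) (sym ∣Q∣≡1+t) (s≤s z≤n))
  with ρ , ρ-exchanges ← exchange t (suc-injective (trans (∣p[x]≔outside∣ x∈P) ∣P∣≡1+t))
                                    (suc-injective (trans (∣p[x]≔outside∣ y∈Q) ∣Q∣≡1+t))
                                    (λ z∈P′ z∈Q′ → disjoint (∈-p[x]≔outside⁻ z∈P′) (∈-p[x]≔outside⁻ z∈Q′))
  = _ , extend-exchange x∈P y∈Q disjoint ρ-exchanges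

relabel : ∀ {n} → (Fin n → Fin n) → Subset n → Subset n
relabel ρ F = tabulate (λ z → lookup F (ρ z))

module _ {n} {ρ : Fin n → Fin n} where

  ∈-relabel⁺ : ∀ {F z} → ρ z ∈ F → z ∈ relabel ρ F
  ∈-relabel⁺ {F} {z} ρz∈F = lookup⇒[]= z (relabel ρ F) (trans (lookup∘tabulate _ z) ([]=⇒lookup ρz∈F))

  ∈-relabel⁻ : ∀ {F z} → z ∈ relabel ρ F → ρ z ∈ F
  ∈-relabel⁻ {F} {z} z∈ = lookup⇒[]= (ρ z) F (trans (sym (lookup∘tabulate _ z)) ([]=⇒lookup z∈))

  module _ (ρ-involutive : ∀ x → ρ (ρ x) ≡ x) where

    relabel-involutive : ∀ F → relabel ρ (relabel ρ F) ≡ F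
    relabel-involutive F = trans (tabulate-cong λ z → trans (lookup∘tabulate _ (ρ z)) (cong (lookup F) (ρ-involutive z)))
                                 (tabulate∘lookup F)

    ∣relabel∣ : ∀ F → ∣ relabel ρ F ∣ ≡ ∣ F ∣
    ∣relabel∣ F = begin
      ∣ relabel ρ F ∣                              ≡⟨ ∣p∣≡countᵇ-lookup (relabel ρ F) ⟩
      countᵇ (lookup (relabel ρ F)) (allFin n)     ≡⟨ countᵇ-cong (allFin n) (lookup∘tabulate _) ⟩
      countᵇ (λ z → lookup F (ρ z)) (allFin n)     ≡⟨ countᵇ-map (lookup F) ρ (allFin n) ⟨
      countᵇ (lookup F) (map ρ (allFin n))         ≡⟨ countᵇ-↭ (lookup F) (map-involution-↭ ρ-involutive (allFin⁺ n) (λ _ → ∈-allFin _)) ⟩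
      countᵇ (lookup F) (allFin n)                 ≡⟨ ∣p∣≡countᵇ-lookup F ⟨
      ∣ F ∣                                        ∎
      where open ≡-Reasoning

-- The optimal product OPT(r) and optimal partitions

5+m≤3[2+m] : ∀ m → 5 + m ≤ 3 * (2 + m)
5+m≤3[2+m] m = subst (5 + m ≤_) (expand m) (m≤m+n (5 + m) (1 + 2 * m))
  where expand : ∀ m → 5 + m + (1 + 2 * m) ≡ 3 * (2 + m)
        expand = solve-∀

optParts : ℕ → List ℕ
optParts 0 = []
optParts 1 = 1 ∷ []
optParts 2 = 2 ∷ []
optParts 3 = 3 ∷ []
optParts 4 = 4 ∷ []
optParts (suc (suc (suc (suc (suc r))))) = 3 ∷ optParts (suc (suc r))

opt : ℕ → ℕ
opt r = product (optParts r)

optParts-positive : ∀ r → All (1 ≤_) (optParts r)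
optParts-positive 0 = []
optParts-positive 1 = s≤s z≤n ∷ []
optParts-positive 2 = s≤s z≤n ∷ []
optParts-positive 3 = s≤s z≤n ∷ []
optParts-positive 4 = s≤s z≤n ∷ []
optParts-positive (suc (suc (suc (suc (suc r))))) = s≤s z≤n ∷ optParts-positive (suc (suc r))

sum-optParts : ∀ r → sum (optParts r) ≡ r
sum-optParts 0 = refl
sum-optParts 1 = refl
sum-optParts 2 = refl
sum-optParts 3 = refl
sum-optParts 4 = refl
sum-optParts (suc (suc (suc (suc (suc r))))) = cong (3 +_) (sum-optParts (suc (suc r)))

opt-suc : ∀ j → opt j ≤ opt (1 + j)
opt-suc 0 = ≤-refl
opt-suc 1 = s≤s z≤n
opt-suc 2 = s≤s (s≤s z≤n)
opt-suc 3 = s≤s (s≤s (s≤s z≤n))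
opt-suc 4 = m≤m+n 4 2
opt-suc (suc (suc (suc (suc (suc j))))) = *-monoʳ-≤ 3 (opt-suc (suc (suc j)))

opt-2+ : ∀ j → 2 * opt j ≤ opt (2 + j)
opt-2+ 0 = ≤-refl
opt-2+ 1 = s≤s (s≤s z≤n)
opt-2+ 2 = ≤-refl
opt-2+ 3 = ≤-refl
opt-2+ 4 = n≤1+n 8
opt-2+ (suc (suc (suc (suc (suc j))))) = begin
  2 * (3 * opt (2 + j))  ≡⟨ x∙yz≈y∙xz 2 3 (opt (2 + j)) ⟩
  3 * (2 * opt (2 + j))  ≤⟨ *-monoʳ-≤ 3 (opt-2+ (suc (suc j))) ⟩
  3 * opt (4 + j)        ∎
  where open ≤-Reasoning

opt-3+ : ∀ j → 3 * opt j ≤ opt (3 + j)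
opt-3+ 0 = ≤-refl
opt-3+ 1 = n≤1+n 3
opt-3+ (suc (suc j)) = ≤-refl

opt-+ : ∀ m j → 1 ≤ m → m * opt j ≤ opt (m + j)
opt-+ 1 j _ = subst (_≤ opt (1 + j)) (sym (*-identityˡ (opt j))) (opt-suc j)
opt-+ 2 j _ = opt-2+ j
opt-+ 3 j _ = opt-3+ j
opt-+ 4 j _ = begin
  4 * opt j        ≡⟨ *-assoc 2 2 (opt j) ⟩
  2 * (2 * opt j)  ≤⟨ *-monoʳ-≤ 2 (opt-2+ j) ⟩
  2 * opt (2 + j)  ≤⟨ opt-2+ (2 + j) ⟩
  opt (4 + j)      ∎
  where open ≤-Reasoning
opt-+ (suc (suc (suc (suc (suc m))))) j _ = begin
  (5 + m) * opt j        ≤⟨ *-monoˡ-≤ (opt j) (5+m≤3[2+m] m) ⟩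
  3 * (2 + m) * opt j    ≡⟨ *-assoc 3 (2 + m) (opt j) ⟩
  3 * ((2 + m) * opt j)  ≤⟨ *-monoʳ-≤ 3 (opt-+ (suc (suc m)) j (s≤s z≤n)) ⟩
  3 * opt (2 + m + j)    ≤⟨ opt-3+ (2 + m + j) ⟩
  opt (5 + m + j)        ∎
  where open ≤-Reasoning

product≤opt-sum : ∀ ms → All (1 ≤_) ms → product ms ≤ opt (sum ms)
product≤opt-sum [] [] = ≤-refl
product≤opt-sum (m ∷ ms) (1≤m ∷ ms-positive) =
  ≤-trans (*-monoʳ-≤ m (product≤opt-sum ms ms-positive)) (opt-+ m (sum ms) 1≤m)

opt-isOPT : ∀ r → IsOPT r (opt r)
opt-isOPT r = (optParts r , optParts-positive r , sum-optParts r , refl)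
            , λ ms ms-positive sum≡r → subst (λ j → product ms ≤ opt j) sum≡r (product≤opt-sum ms ms-positive)

map-allFin-suc : ∀ {a} {A : Set a} {s} (f : Fin (suc s) → A) →
  map f (allFin (suc s)) ≡ f zero ∷ map (λ i → f (suc i)) (allFin s)
map-allFin-suc {s = s} f =
  cong (f zero ∷_) (trans (map-tabulate {n = s} Fin.suc f) (sym (map-tabulate (λ i → i) (λ i → f (suc i)))))

sum-allFin-bump : ∀ {s} (j : Fin s) (f : Fin s → ℕ) →
  sum (map (λ i → if does (j ≟ i) then suc (f i) else f i) (allFin s)) ≡ suc (sum (map f (allFin s)))
sum-allFin-bump {suc s} zero f =
  trans (cong sum (map-allFin-suc (λ i → if does (zero ≟ i) then suc (f i) else f i))) (cong (suc ∘ sum) (sym (map-allFin-suc f)))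
sum-allFin-bump {suc s} (suc j) f =
  trans (cong sum (map-allFin-suc (λ i → if does (suc j ≟ i) then suc (f i) else f i)))
        (trans (cong (f zero +_) (sum-allFin-bump j (λ i → f (suc i))))
               (trans (+-suc (f zero) _) (cong (suc ∘ sum) (sym (map-allFin-suc f)))))

sum-partSizes : ∀ {r s} (C : Fin r → Fin s) → sum (map (partSize C) (allFin s)) ≡ r
sum-partSizes {r} {s} C = begin
  sum (map (partSize C) (allFin s))                                 ≡⟨ cong sum (map-cong (λ i → length-filter≡countᵇ (λ c → C c ≟ i) (allFin r)) (allFin s)) ⟩
  sum (map (λ i → countᵇ (λ c → does (C c ≟ i)) (allFin r)) (allFin s)) ≡⟨ sum-counts (allFin r) ⟩
  length (allFin r)                                                 ≡⟨ length-tabulate (λ c → c) ⟩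
  r                                                                 ∎
  where
    open ≡-Reasoning
    sum-counts : ∀ cs → sum (map (λ i → countᵇ (λ c → does (C c ≟ i)) cs) (allFin s)) ≡ length cs
    sum-counts [] = sum-zeros (allFin s)
      where sum-zeros : ∀ (is : List (Fin s)) → sum (map (λ _ → 0) is) ≡ 0
            sum-zeros [] = refl
            sum-zeros (_ ∷ is) = sum-zeros is
    sum-counts (c ∷ cs) = trans (sum-allFin-bump (C c) _) (cong suc (sum-counts cs))

∃-colour-of-part : ∀ {r s} {C : Fin r → Fin s} i → 1 ≤ partSize C i → ∃[ c ] C c ≡ i
∃-colour-of-part {r} {C = C} i nonempty
  with c , _ , Cc≟i ← countᵇ-pos⁻ (allFin r) (subst (0 <_) (length-filter≡countᵇ (λ c → C c ≟ i) (allFin r)) nonempty)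
  with C c ≟ i
... | yes Cc≡i = c , Cc≡i

partSize≤countᵇ : ∀ {r s} {C : Fin r → Fin s} {p : Fin r → Bool} i → (∀ c → C c ≡ i → p c ≡ true) →
  partSize C i ≤ countᵇ p (allFin r)
partSize≤countᵇ {r} {C = C} {p} i part⇒p =
  subst (_≤ _) (sym (length-filter≡countᵇ (λ c → C c ≟ i) (allFin r))) (countᵇ-mono (allFin r) mono)
  where
    mono : ∀ c → does (C c ≟ i) ≡ true → p c ≡ true
    mono c _ with C c ≟ i
    ... | yes Cc≡i = part⇒p c Cc≡i

unit-part⇒suboptimal : ∀ ms → All (1 ≤_) ms → 1 ∈ₗ ms → 2 ≤ length ms → product ms < opt (sum ms)
unit-part⇒suboptimal ms ms-positive 1∈ms 2≤∣ms∣ with as , bs , refl ← ∈-∃++ 1∈ms =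
  suboptimal (↭.shift 1 as bs)
  where
    product-positive : ∀ {ns} → All (1 ≤_) ns → 1 ≤ product ns
    product-positive [] = ≤-refl
    product-positive (1≤n ∷ ns-positive) = *-mono-≤ 1≤n (product-positive ns-positive)

    suboptimal : ∀ {rest} → ms ↭ 1 ∷ rest → product ms < opt (sum ms)
    suboptimal {[]} ms↭[1] with s≤s () ← ≤-trans 2≤∣ms∣ (≤-reflexive (↭.↭-length ms↭[1]))
    suboptimal {p ∷ rest} ms↭1∷p∷rest = begin-strict
      product ms                ≡⟨ product-↭ ms↭1∷p∷rest ⟩
      1 * (p * product rest)    ≡⟨ *-identityˡ _ ⟩
      p * product rest          <⟨ m<n+m _ (product-positive rest-positive) ⟩
      suc p * product rest      ≤⟨ product≤opt-sum (suc p ∷ rest) (s≤s z≤n ∷ rest-positive) ⟩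
      opt (sum (suc p ∷ rest))  ≡⟨ cong opt (sum-↭ ms↭1∷p∷rest) ⟨
      opt (sum ms)              ∎
      where
        open ≤-Reasoning
        rest-positive : All (1 ≤_) rest
        rest-positive = All.tail (All.tail (↭.All-resp-↭ ms↭1∷p∷rest ms-positive))

optimal-partition⇒parts≥2 : ∀ {r s} {C : Fin r → Fin s} → 2 ≤ s → InFrakC r s C → ∀ i → 2 ≤ partSize C i
optimal-partition⇒parts≥2 {r} {s} {C} 2≤s (nonempty , optimal) i with partSize C i in ∣Cᵢ∣ | nonempty i
... | suc (suc _) | _ = s≤s (s≤s z≤n)
... | suc zero | _ = contradiction (unit-part⇒suboptimal sizes positive 1∈sizes 2≤∣sizes∣) (≤⇒≯ opt≤product)
  where
    sizes : List ℕ
    sizes = map (partSize C) (allFin s)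
    positive : All (1 ≤_) sizes
    positive = All.map⁺ (All.tabulate (λ {j} _ → nonempty j))
    1∈sizes : 1 ∈ₗ sizes
    1∈sizes = subst (_∈ₗ sizes) ∣Cᵢ∣ (∈-map⁺ (partSize C) (∈-allFin i))
    2≤∣sizes∣ : 2 ≤ length sizes
    2≤∣sizes∣ = subst (2 ≤_) (sym (trans (length-map (partSize C) (allFin s)) (length-tabulate (λ j → j)))) 2≤s
    opt≤product : opt (sum sizes) ≤ product sizes
    opt≤product = ≤-reflexive (trans (cong opt (sum-partSizes C)) (sym (optimal (opt r) (opt-isOPT r))))

private
  1⊔n≡n : ∀ {n} → 1 ≤ n → 1 ⊔ n ≡ n
  1⊔n≡n = m≤n⇒m⊔n≡n

  m+n≤m*n : ∀ m n → 2 ≤ m → 2 ≤ n → m + n ≤ m * n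
  m+n≤m*n (suc (suc m)) (suc (suc n)) _ _ =
    subst (2 + m + (2 + n) ≤_) (expand m n) (m≤m+n (2 + m + (2 + n)) (m + n + m * n))
    where expand : ∀ m n → 2 + m + (2 + n) + (m + n + m * n) ≡ (2 + m) * (2 + n)
          expand = solve-∀
  m+n≤m*n (suc zero) _ (s≤s ()) _
  m+n≤m*n (suc (suc m)) (suc zero) _ (s≤s ())

  6[m+n]≤5mn : ∀ m n → 2 ≤ m → 2 ≤ n → 3 ≤ m ⊎ 3 ≤ n → 6 * (m + n) ≤ 5 * (m * n)
  6[m+n]≤5mn (suc (suc (suc m))) (suc (suc n)) _ _ _ =
    subst (6 * (3 + m + (2 + n)) ≤_) (expand m n) (m≤m+n _ (9 * n + 4 * m + 5 * (m * n)))
    where expand : ∀ m n → 6 * (3 + m + (2 + n)) + (9 * n + 4 * m + 5 * (m * n)) ≡ 5 * ((3 + m) * (2 + n))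
          expand = solve-∀
  6[m+n]≤5mn (suc (suc m)) (suc (suc (suc n))) _ _ _ =
    subst (6 * (2 + m + (3 + n)) ≤_) (expand m n) (m≤m+n _ (9 * m + 4 * n + 5 * (m * n)))
    where expand : ∀ m n → 6 * (2 + m + (3 + n)) + (9 * m + 4 * n + 5 * (m * n)) ≡ 5 * ((2 + m) * (3 + n))
          expand = solve-∀
  6[m+n]≤5mn 2 2 _ _ (inj₁ (s≤s (s≤s ())))
  6[m+n]≤5mn 2 2 _ _ (inj₂ (s≤s (s≤s ())))
  6[m+n]≤5mn (suc zero) _ (s≤s ()) _ _
  6[m+n]≤5mn (suc (suc m)) (suc zero) _ (s≤s ()) _

-- The c colours of the last part move from a k-set of weight b to its partner of weight a ≤ b, each
-- k-set contributing the factor 1 ⊔ weight; b ≡ 0 ⊎ 2 ≤ b because every part has two colours or more.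
move-colours-≤ : ∀ a b c → a ≤ b → 2 ≤ c → b ≡ 0 ⊎ 2 ≤ b →
  (1 ⊔ (b + c)) * (1 ⊔ a) ≤ (1 ⊔ b) * (1 ⊔ (a + c))
move-colours-≤ zero zero c _ _ _ = ≤-reflexive (*-comm (1 ⊔ c) 1)
move-colours-≤ zero b c _ 2≤c (inj₂ 2≤b)
  rewrite 1⊔n≡n (≤-trans (s≤s z≤n) (≤-trans 2≤b (m≤m+n b c))) | 1⊔n≡n {b} (≤-trans (s≤s z≤n) 2≤b)
        | 1⊔n≡n {c} (≤-trans (s≤s z≤n) 2≤c) | *-identityʳ (b + c) = m+n≤m*n b c 2≤b 2≤c
move-colours-≤ (suc a) b c a<b _ _
  rewrite 1⊔n≡n (≤-trans (s≤s z≤n) (≤-trans a<b (m≤m+n b c))) | 1⊔n≡n {b} (≤-trans (s≤s z≤n) a<b) = begin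
    (b + c) * suc a          ≡⟨ *-distribʳ-+ (suc a) b c ⟩
    b * suc a + c * suc a    ≤⟨ +-monoʳ-≤ (b * suc a) (≤-trans (≤-reflexive (*-comm c (suc a))) (*-monoˡ-≤ c a<b)) ⟩
    b * suc a + b * c        ≡⟨ *-distribˡ-+ b (suc a) c ⟨
    b * (suc a + c)          ∎
  where open ≤-Reasoning

move-colours-6/5 : ∀ b c → 2 ≤ b → 2 ≤ c → 3 ≤ b ⊎ 3 ≤ c →
  6 * ((1 ⊔ (b + c)) * (1 ⊔ 0)) ≤ 5 * ((1 ⊔ b) * (1 ⊔ (0 + c)))
move-colours-6/5 b c 2≤b 2≤c 3≤b∨c
  rewrite 1⊔n≡n (≤-trans (s≤s z≤n) (≤-trans 2≤b (m≤m+n b c))) | 1⊔n≡n {b} (≤-trans (s≤s z≤n) 2≤b)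
        | 1⊔n≡n {c} (≤-trans (s≤s z≤n) 2≤c) | *-identityʳ (b + c) = 6[m+n]≤5mn b c 2≤b 2≤c 3≤b∨c

-- Colourings as a product of weights

weight : ∀ {n r s} → (Fin s → Subset n) → (Fin r → Fin s) → Subset n → ℕ
weight {r = r} T C F = countᵇ (λ c → T (C c) ⊆ᵇ F) (allFin r)

module _ {n r s} (k : ℕ) (T : Fin s → Subset n) (C : Fin r → Fin s) (nonempty : ∀ i → 1 ≤ partSize C i) where

  private
    factor≡1⊔weight : ∀ F → (if does (any? (λ i → T i ⊆? F)) then choices (allowed? T C) F else 1) ≡ 1 ⊔ weight T C F
    factor≡1⊔weight F with any? (λ i → T i ⊆? F)
    ... | yes (i , Tᵢ⊆F) with c , refl ← ∃-colour-of-part {C = C} i (nonempty i) =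
      trans choices≡weight (sym (1⊔n≡n (countᵇ-pos (allFin r) (∈-allFin c) (dec-true (T (C c) ⊆? F) Tᵢ⊆F))))
      where
        choices≡weight : choices (allowed? T C) F ≡ weight T C F
        choices≡weight = countᵇ-cong (allFin r) λ c →
          does-⇔ (mk⇔ (λ { (_ , T⊆F , refl) → T⊆F }) (λ T⊆F → C c , T⊆F , refl)) (allowed? T C F c) (T (C c) ⊆? F)
    ... | no ¬union = cong (1 ⊔_) (sym (countᵇ-none (allFin r) λ c → dec-false (T (C c) ⊆? F) (λ T⊆F → ¬union (C c , T⊆F))))

  numColourings≡∏weight : numColourings k T C ≡ ∏ (λ F → 1 ⊔ weight T C F) (kSubsets n k)
  numColourings≡∏weight = begin
    numColourings k T C                                       ≡⟨ admissible-colourings (allowed? T C) (starUnion k T) ⟩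
    ∏ (choices (allowed? T C)) (starUnion k T)                ≡⟨ ∏-filter (λ F → any? (λ i → T i ⊆? F)) _ (kSubsets n k) ⟩
    ∏ (λ F → if does (any? (λ i → T i ⊆? F)) then choices (allowed? T C) F else 1) (kSubsets n k)
                                                              ≡⟨ ∏-cong (kSubsets n k) factor≡1⊔weight ⟩
    ∏ (λ F → 1 ⊔ weight T C F) (kSubsets n k)                 ∎
    where open ≡-Reasoning

-- Replacing the last centre

module Replacement {n r s} (k : ℕ) (C : Fin r → Fin s) (parts≥2 : ∀ i → 2 ≤ partSize C i)
                   (T T′ : Fin s → Subset n) (ℓ : Fin s) (T′-other : ∀ i → i ≢ ℓ → T′ i ≡ T i)
                   (T′ℓ-disjoint : ∀ i {x} → x ∈ T′ ℓ → x ∉ T i)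
                   {ρ : Fin n → Fin n} (ρ-exchanges : Exchanges (T ℓ) (T′ ℓ) ρ) where

  open Exchanges ρ-exchanges

  σ : Subset n → Subset n
  σ = relabel ρ

  others : Subset n → ℕ
  others F = countᵇ (λ c → not (does (C c ≟ ℓ)) ∧ T (C c) ⊆ᵇ F) (allFin r)

  private
    Tℓ T̃ : Subset n
    Tℓ = T ℓ
    T̃ = T′ ℓ

    cℓ : ℕ
    cℓ = partSize C ℓ

    w : Subset n → Bool → ℕ
    w F b = 1 ⊔ (if b then others F + cℓ else others F)

    weight-split : ∀ (T₀ : Fin s → Subset n) → (∀ i → i ≢ ℓ → T₀ i ≡ T i) → ∀ F →
      1 ⊔ weight T₀ C F ≡ w F (T₀ ℓ ⊆ᵇ F)
    weight-split T₀ T₀-other F = cong (1 ⊔_) (begin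
      weight T₀ C F
        ≡⟨ countᵇ-split (λ c → does (C c ≟ ℓ)) _ (allFin r) ⟩
      countᵇ (λ c → not (does (C c ≟ ℓ)) ∧ T₀ (C c) ⊆ᵇ F) (allFin r) + countᵇ (λ c → does (C c ≟ ℓ) ∧ T₀ (C c) ⊆ᵇ F) (allFin r)
        ≡⟨ cong₂ _+_ (countᵇ-cong (allFin r) off-ℓ) (countᵇ-cong (allFin r) at-ℓ) ⟩
      others F + countᵇ (λ c → does (C c ≟ ℓ) ∧ T₀ ℓ ⊆ᵇ F) (allFin r)
        ≡⟨ cong (others F +_) (countᵇ-∧-const (λ c → does (C c ≟ ℓ)) (T₀ ℓ ⊆ᵇ F) (allFin r)) ⟩
      others F + (if T₀ ℓ ⊆ᵇ F then countᵇ (λ c → does (C c ≟ ℓ)) (allFin r) else 0)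
        ≡⟨ block (T₀ ℓ ⊆ᵇ F) ⟩
      (if T₀ ℓ ⊆ᵇ F then others F + cℓ else others F) ∎)
      where
        open ≡-Reasoning
        off-ℓ : ∀ c → (not (does (C c ≟ ℓ)) ∧ T₀ (C c) ⊆ᵇ F) ≡ (not (does (C c ≟ ℓ)) ∧ T (C c) ⊆ᵇ F)
        off-ℓ c with C c ≟ ℓ
        ... | yes _ = refl
        ... | no Cc≢ℓ = cong (_⊆ᵇ F) (T₀-other (C c) Cc≢ℓ)
        at-ℓ : ∀ c → (does (C c ≟ ℓ) ∧ T₀ (C c) ⊆ᵇ F) ≡ (does (C c ≟ ℓ) ∧ T₀ ℓ ⊆ᵇ F)
        at-ℓ c with C c ≟ ℓ
        ... | yes Cc≡ℓ = cong (λ i → T₀ i ⊆ᵇ F) Cc≡ℓ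
        ... | no _ = refl
        block : ∀ b → others F + (if b then countᵇ (λ c → does (C c ≟ ℓ)) (allFin r) else 0)
                      ≡ (if b then others F + cℓ else others F)
        block true = cong (others F +_) (sym (length-filter≡countᵇ (λ c → C c ≟ ℓ) (allFin r)))
        block false = +-identityʳ (others F)

  Tℓ⊆σF⇔T̃⊆F : ∀ F → Tℓ ⊆ᵇ σ F ≡ T̃ ⊆ᵇ F
  Tℓ⊆σF⇔T̃⊆F F = does-⇔ (mk⇔ to from) (Tℓ ⊆? σ F) (T̃ ⊆? F)
    where
      to : Tℓ ⊆ σ F → T̃ ⊆ F
      to Tℓ⊆σF {x} x∈T̃ = subst (_∈ F) (involutive x) (∈-relabel⁻ (Tℓ⊆σF (Q→P x∈T̃)))
      from : T̃ ⊆ F → Tℓ ⊆ σ F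
      from T̃⊆F x∈Tℓ = ∈-relabel⁺ (T̃⊆F (P→Q x∈Tℓ))

  T̃⊆σF⇔Tℓ⊆F : ∀ F → T̃ ⊆ᵇ σ F ≡ Tℓ ⊆ᵇ F
  T̃⊆σF⇔Tℓ⊆F F = trans (sym (Tℓ⊆σF⇔T̃⊆F (σ F))) (cong (Tℓ ⊆ᵇ_) (relabel-involutive involutive F))

  σ-kSubsets : ∀ {F} → F ∈ₗ kSubsets n k → σ F ∈ₗ kSubsets n k
  σ-kSubsets {F} F∈ = ∈-kSubsets⁺ (trans (∣relabel∣ {ρ = ρ} involutive F) (∈-kSubsets⁻ F∈))

  -- Points outside Tℓ ∪ T̃ are fixed by ρ, and T̃ meets no centre.
  Tᵢ⊆σF⇒Tᵢ⊆F : ∀ {F} i → Tℓ ⊆ F → T i ⊆ σ F → T i ⊆ F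
  Tᵢ⊆σF⇒Tᵢ⊆F {F} i Tℓ⊆F Tᵢ⊆σF {x} x∈Tᵢ with x ∈? Tℓ
  ... | yes x∈Tℓ = Tℓ⊆F x∈Tℓ
  ... | no x∉Tℓ = subst (_∈ F) (fixes x∉Tℓ (λ x∈T̃ → T′ℓ-disjoint i x∈T̃ x∈Tᵢ)) (∈-relabel⁻ (Tᵢ⊆σF x∈Tᵢ))

  others-σ≤ : ∀ {F} → Tℓ ⊆ F → others (σ F) ≤ others F
  others-σ≤ {F} Tℓ⊆F = countᵇ-mono (allFin r) mono
    where
      mono : ∀ c → (not (does (C c ≟ ℓ)) ∧ T (C c) ⊆ᵇ σ F) ≡ true → (not (does (C c ≟ ℓ)) ∧ T (C c) ⊆ᵇ F) ≡ true
      mono c counted with does (C c ≟ ℓ)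
      ... | false = dec-true (T (C c) ⊆? F) (Tᵢ⊆σF⇒Tᵢ⊆F (C c) Tℓ⊆F (⊆ᵇ⇒⊆ counted))

  -- A counted colour brings its whole part, of size at least 2.
  others≡0⊎2≤others : ∀ F → others F ≡ 0 ⊎ 2 ≤ others F
  others≡0⊎2≤others F with others F in others≡
  ... | zero = inj₁ refl
  ... | suc _ with c , _ , counted ← countᵇ-pos⁻ (allFin r) (subst (0 <_) (sym others≡) (s≤s z≤n)) =
    inj₂ (subst (2 ≤_) others≡ (≤-trans (parts≥2 (C c)) (partSize≤countᵇ (C c) same-part)))
    where
      same-part : ∀ c′ → C c′ ≡ C c → (not (does (C c′ ≟ ℓ)) ∧ T (C c′) ⊆ᵇ F) ≡ true
      same-part c′ Cc′≡Cc rewrite Cc′≡Cc = counted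

  X : Subset n → Bool
  X F = Tℓ ⊆ᵇ F ∧ not (T̃ ⊆ᵇ F)

  X-σ≡ : ∀ F → X (σ F) ≡ (T̃ ⊆ᵇ F ∧ not (Tℓ ⊆ᵇ F))
  X-σ≡ F = cong₂ (λ a b → a ∧ not b) (Tℓ⊆σF⇔T̃⊆F F) (T̃⊆σF⇔Tℓ⊆F F)

  X-σ : ∀ F → X F ≡ true → X (σ F) ≡ false
  X-σ F XF = trans (X-σ≡ F) (exclusive (Tℓ ⊆ᵇ F) (T̃ ⊆ᵇ F) XF)
    where
      exclusive : ∀ a b → a ∧ not b ≡ true → b ∧ not a ≡ false
      exclusive true false _ = refl

  private
    before after : Bool → Bool → (Bool → ℕ) → (Bool → ℕ) → ℕ
    before a b u v = if a ∧ not b then u a * v b else if b ∧ not a then 1 else u a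
    after a b u v = if a ∧ not b then u b * v a else if b ∧ not a then 1 else u b

    before≤after : ∀ a b (u v : Bool → ℕ) → (a ≡ true → b ≡ false → u true * v false ≤ u false * v true) →
      before a b u v ≤ after a b u v
    before≤after true false u v gain = gain refl refl
    before≤after true true u v _ = ≤-refl
    before≤after false true u v _ = ≤-refl
    before≤after false false u v _ = ≤-refl

    f f′ : Subset n → ℕ
    f F = w F (Tℓ ⊆ᵇ F)
    f′ F = w F (T̃ ⊆ᵇ F)

    pairs : (Subset n → ℕ) → Subset n → ℕ
    pairs = pairUp {σ = σ} (relabel-involutive involutive) X X-σ

    pairs-f : ∀ F → pairs f F ≡ before (Tℓ ⊆ᵇ F) (T̃ ⊆ᵇ F) (w F) (w (σ F))
    pairs-f F = cong₂ (λ q z → if X F then f F * z else if q then 1 else f F) (X-σ≡ F) (cong (w (σ F)) (Tℓ⊆σF⇔T̃⊆F F))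

    pairs-f′ : ∀ F → pairs f′ F ≡ after (Tℓ ⊆ᵇ F) (T̃ ⊆ᵇ F) (w F) (w (σ F))
    pairs-f′ F = cong₂ (λ q z → if X F then f′ F * z else if q then 1 else f′ F) (X-σ≡ F) (cong (w (σ F)) (T̃⊆σF⇔Tℓ⊆F F))

    pairs-≤ : ∀ F → pairs f F ≤ pairs f′ F
    pairs-≤ F = subst₂ _≤_ (sym (pairs-f F)) (sym (pairs-f′ F)) (before≤after _ _ (w F) (w (σ F)) gain)
      where
        gain : Tℓ ⊆ᵇ F ≡ true → T̃ ⊆ᵇ F ≡ false → w F true * w (σ F) false ≤ w F false * w (σ F) true
        gain Tℓ⊆F _ = move-colours-≤ (others (σ F)) (others F) cℓ (others-σ≤ (⊆ᵇ⇒⊆ Tℓ⊆F)) (parts≥2 ℓ) (others≡0⊎2≤others F)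

    numColourings≡∏pairs : ∀ (T₀ : Fin s → Subset n) (T₀-other : ∀ i → i ≢ ℓ → T₀ i ≡ T i) →
      numColourings k T₀ C ≡ ∏ (pairs (λ F → w F (T₀ ℓ ⊆ᵇ F))) (kSubsets n k)
    numColourings≡∏pairs T₀ T₀-other =
      trans (numColourings≡∏weight k T₀ C (λ i → ≤-trans (s≤s z≤n) (parts≥2 i)))
            (trans (∏-cong (kSubsets n k) (weight-split T₀ T₀-other))
                   (∏-pairUp (relabel-involutive involutive) X X-σ _ (kSubsets-unique n k) σ-kSubsets))

  numColourings-≤ : numColourings k T C ≤ numColourings k T′ C
  numColourings-≤ = begin
    numColourings k T C               ≡⟨ numColourings≡∏pairs T (λ _ _ → refl) ⟩
    ∏ (pairs f) (kSubsets n k)        ≤⟨ ∏-mono-≤ (kSubsets n k) pairs-≤ ⟩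
    ∏ (pairs f′) (kSubsets n k)       ≡⟨ numColourings≡∏pairs T′ T′-other ⟨
    numColourings k T′ C              ∎
    where open ≤-Reasoning

  witness⇒numColourings-6/5 : ∀ {F₀} → ∣ F₀ ∣ ≡ k → Tℓ ⊆ F₀ → ¬ T̃ ⊆ F₀ → others (σ F₀) ≡ 0 → 2 ≤ others F₀ →
    3 ≤ others F₀ ⊎ 3 ≤ cℓ → 6 * numColourings k T C ≤ 5 * numColourings k T′ C
  witness⇒numColourings-6/5 {F₀} ∣F₀∣≡k Tℓ⊆F₀ T̃⊈F₀ others-σF₀≡0 2≤others 3≤others∨cℓ = begin
    6 * numColourings k T C           ≡⟨ cong (6 *_) (numColourings≡∏pairs T (λ _ _ → refl)) ⟩
    6 * ∏ (pairs f) (kSubsets n k)    ≤⟨ ∏-mono-ratio 6 5 (kSubsets n k) (∈-kSubsets⁺ ∣F₀∣≡k) pairs-≤ gain ⟩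
    5 * ∏ (pairs f′) (kSubsets n k)   ≡⟨ cong (5 *_) (numColourings≡∏pairs T′ T′-other) ⟨
    5 * numColourings k T′ C          ∎
    where
      open ≤-Reasoning
      gain : 6 * pairs f F₀ ≤ 5 * pairs f′ F₀
      gain rewrite pairs-f F₀ | pairs-f′ F₀ | dec-true (Tℓ ⊆? F₀) Tℓ⊆F₀ | dec-false (T̃ ⊆? F₀) T̃⊈F₀ | others-σF₀≡0 =
        move-colours-6/5 (others F₀) cℓ 2≤others (parts≥2 ℓ) 3≤others∨cℓ

-- A k-set witnessing the 6/5 gain

module Witness {n r s} (k t : ℕ) (C : Fin r → Fin s) (parts≥2 : ∀ i → 2 ≤ partSize C i)
               (T T′ : Fin s → Subset n) (ℓ : Fin s) (T′-other : ∀ i → i ≢ ℓ → T′ i ≡ T i)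
               (T′ℓ-disjoint : ∀ i {x} → x ∈ T′ ℓ → x ∉ T i)
               {ρ : Fin n → Fin n} (ρ-exchanges : Exchanges (T ℓ) (T′ ℓ) ρ)
               (∣Tᵢ∣≡t : ∀ i → ∣ T i ∣ ≡ t) (∣T′ℓ∣≡t : ∣ T′ ℓ ∣ ≡ t) (1≤t : 1 ≤ t)
               (room : k + suc s * t ≤ n) (i₀ : Fin s) (i₀≢ℓ : i₀ ≢ ℓ)
               (large-overlap : 1 ⊔ (2 * t ∸ k) ≤ ∣ T i₀ ∩ T ℓ ∣) where

  open Replacement k C parts≥2 T T′ ℓ T′-other T′ℓ-disjoint ρ-exchanges
  open Exchanges ρ-exchanges

  private
    Tℓ T̃ : Subset n
    Tℓ = T ℓ
    T̃ = T′ ℓ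

  U : Subset n
  U = ⋃ (T̃ ∷ map T (allFin s))

  Tᵢ⊆U : ∀ i → T i ⊆ U
  Tᵢ⊆U i = p∈ps⇒p⊆⋃ps {ps = T̃ ∷ map T (allFin s)} (there (∈-map⁺ T (∈-allFin i)))

  T̃⊆U : T̃ ⊆ U
  T̃⊆U = p∈ps⇒p⊆⋃ps {ps = T̃ ∷ map T (allFin s)} (here refl)

  k≤∣∁U∣ : k ≤ ∣ ∁ U ∣
  k≤∣∁U∣ = subst (k ≤_) (sym (∣∁p∣≡n∸∣p∣ U)) (m+n≤o⇒m≤o∸n k (≤-trans (+-monoʳ-≤ k ∣U∣≤) room))
    where
      ∣p∣≤t : ∀ {p} → p ∈ₗ T̃ ∷ map T (allFin s) → ∣ p ∣ ≤ t
      ∣p∣≤t (here refl) = ≤-reflexive ∣T′ℓ∣≡t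
      ∣p∣≤t (there p∈) with i , _ , refl ← ∈-map⁻ T p∈ = ≤-reflexive (∣Tᵢ∣≡t i)
      ∣U∣≤ : ∣ U ∣ ≤ suc s * t
      ∣U∣≤ = subst (λ l → ∣ U ∣ ≤ l * t) (cong suc (trans (length-map T (allFin s)) (length-tabulate {n = s} (λ i → i))))
                   (∣⋃ps∣≤ t (T̃ ∷ map T (allFin s)) ∣p∣≤t)

  V : Subset n
  V = T i₀ ∪ Tℓ

  ∣V∣≤k : ∣ V ∣ ≤ k
  ∣V∣≤k = +-cancelʳ-≤ (2 * t ∸ k) ∣ V ∣ k (begin
    ∣ V ∣ + (2 * t ∸ k)          ≤⟨ +-monoʳ-≤ ∣ V ∣ (m⊔n≤o⇒n≤o 1 (2 * t ∸ k) large-overlap) ⟩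
    ∣ V ∣ + ∣ T i₀ ∩ Tℓ ∣        ≡⟨ ∣p∪q∣+∣p∩q∣≡∣p∣+∣q∣ (T i₀) Tℓ ⟩
    ∣ T i₀ ∣ + ∣ Tℓ ∣            ≡⟨ cong₂ _+_ (∣Tᵢ∣≡t i₀) (∣Tᵢ∣≡t ℓ) ⟩
    t + t                        ≡⟨ cong (t +_) (+-identityʳ t) ⟨
    2 * t                        ≤⟨ m≤n+m∸n (2 * t) k ⟩
    k + (2 * t ∸ k)              ∎)
    where open ≤-Reasoning

  private
    R-spec : ∃[ R ] R ⊆ ∁ U × ∣ R ∣ ≡ k ∸ ∣ V ∣
    R-spec = ∃-⊆-of-size (∁ U) (≤-trans (m∸n≤m k ∣ V ∣) k≤∣∁U∣)

  R : Subset n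
  R = proj₁ R-spec

  x∈R⇒x∉U : ∀ {x} → x ∈ R → x ∉ U
  x∈R⇒x∉U x∈R = x∈∁p⇒x∉p (proj₁ (proj₂ R-spec) x∈R)

  F₀ : Subset n
  F₀ = V ∪ R

  ∣F₀∣≡k : ∣ F₀ ∣ ≡ k
  ∣F₀∣≡k = begin
    ∣ V ∪ R ∣            ≡⟨ disjoint⇒∣p∪q∣≡∣p∣+∣q∣ V R (λ x∈V x∈R → x∈R⇒x∉U x∈R (V⊆U x∈V)) ⟩
    ∣ V ∣ + ∣ R ∣        ≡⟨ cong (∣ V ∣ +_) (proj₂ (proj₂ R-spec)) ⟩
    ∣ V ∣ + (k ∸ ∣ V ∣)  ≡⟨ m+[n∸m]≡n ∣V∣≤k ⟩
    k                    ∎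
    where
      open ≡-Reasoning
      V⊆U : V ⊆ U
      V⊆U x∈V = [ Tᵢ⊆U i₀ , Tᵢ⊆U ℓ ]′ (x∈p∪q⁻ (T i₀) Tℓ x∈V)

  Tℓ⊆F₀ : Tℓ ⊆ F₀
  Tℓ⊆F₀ = p⊆p∪q R ∘ q⊆p∪q (T i₀) Tℓ

  Tᵢ₀⊆F₀ : T i₀ ⊆ F₀
  Tᵢ₀⊆F₀ = p⊆p∪q R ∘ p⊆p∪q Tℓ

  x∈T̃⇒x∉F₀ : ∀ {x} → x ∈ T̃ → x ∉ F₀
  x∈T̃⇒x∉F₀ x∈T̃ x∈F₀ with x∈p∪q⁻ V R x∈F₀
  ... | inj₂ x∈R = x∈R⇒x∉U x∈R (T̃⊆U x∈T̃)
  ... | inj₁ x∈V with x∈p∪q⁻ (T i₀) Tℓ x∈V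
  ...   | inj₁ x∈Tᵢ₀ = T′ℓ-disjoint i₀ x∈T̃ x∈Tᵢ₀
  ...   | inj₂ x∈Tℓ = T′ℓ-disjoint ℓ x∈T̃ x∈Tℓ

  T̃⊈F₀ : ¬ T̃ ⊆ F₀
  T̃⊈F₀ T̃⊆F₀ with y , y∈T̃ ← ∣p∣>0⇒Nonempty T̃ (subst (0 <_) (sym ∣T′ℓ∣≡t) 1≤t) = x∈T̃⇒x∉F₀ y∈T̃ (T̃⊆F₀ y∈T̃)

  -- A centre inside σ F₀ would avoid Tℓ, hence lie in T i₀ while missing a point of T i₀ ∩ Tℓ.
  Tᵢ⊈σF₀ : ∀ i → ¬ T i ⊆ σ F₀
  Tᵢ⊈σF₀ i Tᵢ⊆σF₀ with x₀ , x₀∈Tᵢ₀∩Tℓ ← ∣p∣>0⇒Nonempty (T i₀ ∩ Tℓ) (m⊔n≤o⇒m≤o 1 (2 * t ∸ k) large-overlap) =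
    <-irrefl (trans (∣Tᵢ∣≡t i) (sym (∣Tᵢ∣≡t i₀))) (p⊂q⇒∣p∣<∣q∣ (Tᵢ⊆Tᵢ₀ , x₀ , x₀∈Tᵢ₀ , x₀∉Tᵢ))
    where
      x∈Tᵢ⇒x∉Tℓ : ∀ {x} → x ∈ T i → x ∉ Tℓ
      x∈Tᵢ⇒x∉Tℓ x∈Tᵢ x∈Tℓ = x∈T̃⇒x∉F₀ (P→Q x∈Tℓ) (∈-relabel⁻ (Tᵢ⊆σF₀ x∈Tᵢ))

      x∈Tᵢ⇒x∈F₀ : ∀ {x} → x ∈ T i → x ∈ F₀
      x∈Tᵢ⇒x∈F₀ x∈Tᵢ =
        subst (_∈ F₀) (fixes (x∈Tᵢ⇒x∉Tℓ x∈Tᵢ) (λ x∈T̃ → T′ℓ-disjoint i x∈T̃ x∈Tᵢ)) (∈-relabel⁻ (Tᵢ⊆σF₀ x∈Tᵢ))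

      Tᵢ⊆Tᵢ₀ : T i ⊆ T i₀
      Tᵢ⊆Tᵢ₀ {x} x∈Tᵢ with x∈p∪q⁻ V R (x∈Tᵢ⇒x∈F₀ x∈Tᵢ)
      ... | inj₂ x∈R = contradiction (Tᵢ⊆U i x∈Tᵢ) (x∈R⇒x∉U x∈R)
      ... | inj₁ x∈V with x∈p∪q⁻ (T i₀) Tℓ x∈V
      ...   | inj₁ x∈Tᵢ₀ = x∈Tᵢ₀
      ...   | inj₂ x∈Tℓ = contradiction x∈Tℓ (x∈Tᵢ⇒x∉Tℓ x∈Tᵢ)

      x₀∈Tᵢ₀ : x₀ ∈ T i₀
      x₀∈Tᵢ₀ = proj₁ (x∈p∩q⁻ (T i₀) Tℓ x₀∈Tᵢ₀∩Tℓ)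

      x₀∉Tᵢ : x₀ ∉ T i
      x₀∉Tᵢ x₀∈Tᵢ = x∈Tᵢ⇒x∉Tℓ x₀∈Tᵢ (proj₂ (x∈p∩q⁻ (T i₀) Tℓ x₀∈Tᵢ₀∩Tℓ))

  others-σF₀≡0 : others (σ F₀) ≡ 0
  others-σF₀≡0 = countᵇ-none (allFin r) λ c →
    trans (cong (not (does (C c ≟ ℓ)) ∧_) (dec-false (T (C c) ⊆? σ F₀) (Tᵢ⊈σF₀ (C c)))) (∧-zeroʳ _)

  ∣Cᵢ₀∣≤others-F₀ : partSize C i₀ ≤ others F₀
  ∣Cᵢ₀∣≤others-F₀ = partSize≤countᵇ i₀ counted
    where
      counted : ∀ c → C c ≡ i₀ → (not (does (C c ≟ ℓ)) ∧ T (C c) ⊆ᵇ F₀) ≡ true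
      counted c Cc≡i₀ rewrite Cc≡i₀ | dec-false (i₀ ≟ ℓ) i₀≢ℓ | dec-true (T i₀ ⊆? F₀) Tᵢ₀⊆F₀ = refl

  numColourings-6/5 : ¬ (partSize C i₀ ≡ 2 × partSize C ℓ ≡ 2) → 6 * numColourings k T C ≤ 5 * numColourings k T′ C
  numColourings-6/5 ¬both-2 =
    witness⇒numColourings-6/5 ∣F₀∣≡k Tℓ⊆F₀ T̃⊈F₀ others-σF₀≡0 (≤-trans (parts≥2 i₀) ∣Cᵢ₀∣≤others-F₀) some-part≥3
    where
      some-part≥3 : 3 ≤ others F₀ ⊎ 3 ≤ partSize C ℓ
      some-part≥3 with partSize C ℓ ≟ℕ 2
      ... | no ∣Cℓ∣≢2 = inj₂ (≤∧≢⇒< (parts≥2 ℓ) (∣Cℓ∣≢2 ∘ sym))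
      ... | yes ∣Cℓ∣≡2 =
        inj₁ (≤-trans (≤∧≢⇒< (parts≥2 i₀) (λ 2≡∣Cᵢ₀∣ → ¬both-2 (sym 2≡∣Cᵢ₀∣ , ∣Cℓ∣≡2))) ∣Cᵢ₀∣≤others-F₀)

PartCount : ℕ → ℕ → Set
PartCount r s = s ≡ (r + 2) / 3 ⊎ (r % 3 ≡ 1 × s ≡ r / 3)

3[1+m]≤r+2 : ∀ {r m} → PartCount r (suc m) → 3 * suc m ≤ r + 2
3[1+m]≤r+2 {r} {m} (inj₁ s≡) = subst (_≤ r + 2) (trans (cong (_* 3) (sym s≡)) (*-comm (suc m) 3)) (m/n*n≤m (r + 2) 3)
3[1+m]≤r+2 {r} {m} (inj₂ (_ , s≡)) =
  ≤-trans (subst (_≤ r) (trans (cong (_* 3) (sym s≡)) (*-comm (suc m) 3)) (m/n*n≤m r 3)) (m≤m+n r 2)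

1≤m : ∀ {r m} → 5 ≤ r → PartCount r (suc m) → 1 ≤ m
1≤m {m = suc _} _ _ = s≤s z≤n
1≤m {r} {zero} 5≤r (inj₁ 1≡[r+2]/3) with s≤s () ← subst (2 ≤_) (sym 1≡[r+2]/3) (/-monoˡ-≤ 3 (+-monoˡ-≤ 2 5≤r))
1≤m {r} {zero} 5≤r (inj₂ (r%3≡1 , 1≡r/3))
  with s≤s (s≤s (s≤s (s≤s ()))) ← subst (5 ≤_) (trans (m≡m%n+[m/n]*n r 3) (cong₂ (λ a b → a + b * 3) r%3≡1 (sym 1≡r/3))) 5≤r

2+m≤r : ∀ {r m} → 1 ≤ m → PartCount r (suc m) → 2 + m ≤ r
2+m≤r {r} {suc m} _ s-choice =
  +-cancelʳ-≤ 2 (3 + m) r (≤-trans (≤-reflexive (cong (3 +_) (+-comm m 2))) (≤-trans (5+m≤3[2+m] m) (3[1+m]≤r+2 s-choice)))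

replaceLast-last : ∀ {n m} (T : Fin (suc m) → Subset n) T̃ → replaceLast T T̃ (fromℕ m) ≡ T̃
replaceLast-last {m = m} T T̃ with fromℕ m ≟ fromℕ m
... | yes _ = refl
... | no ≢ = contradiction refl ≢

replaceLast-other : ∀ {n m} (T : Fin (suc m) → Subset n) T̃ i → i ≢ fromℕ m → replaceLast T T̃ i ≡ T i
replaceLast-other {m = m} T T̃ i i≢ with i ≟ fromℕ m
... | yes i≡ = contradiction i≡ i≢
... | no _ = refl

0≢fromℕ : ∀ {m} → 1 ≤ m → zero ≢ fromℕ m
0≢fromℕ {suc m} _ ()

lemma3p6 : (n k t r m : ℕ) →
    t < k → 1 ≤ t → 5 ≤ r → k + r * t ≤ n →
    (suc m ≡ (r + 2) / 3 ⊎ (r % 3 ≡ 1 × suc m ≡ r / 3)) →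
    (T : Fin (suc m) → Subset n) →
    (∀ i → ∣ T i ∣ ≡ t) →
    (∀ i j → T i ≡ T j → i ≡ j) →
    1 ⊔ (2 * t ∸ k) ≤ ∣ T zero ∩ T (fromℕ m) ∣ →
    (T̃ : Subset n) → ∣ T̃ ∣ ≡ t →
    (∀ i x → x ∈ T̃ → x ∉ T i) →
    (C : Fin r → Fin (suc m)) → InFrakC r (suc m) C →
    (partSize C zero ≡ 2 × partSize C (fromℕ m) ≡ 2 →
      numColourings k T C ≤ numColourings k (replaceLast T T̃) C)
    × (¬ (partSize C zero ≡ 2 × partSize C (fromℕ m) ≡ 2) →
      6 * numColourings k T C ≤ 5 * numColourings k (replaceLast T T̃) C)
lemma3p6 n k t r m _ 1≤t 5≤r k+rt≤n s-choice T ∣Tᵢ∣≡t _ large-overlap T̃ ∣T̃∣≡t T̃-disjoint C C-optimal =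
  (λ _ → numColourings-≤) , numColourings-6/5
  where
    ℓ : Fin (suc m)
    ℓ = fromℕ m

    T′ : Fin (suc m) → Subset n
    T′ = replaceLast T T̃

    m≥1 : 1 ≤ m
    m≥1 = 1≤m 5≤r s-choice

    parts≥2 : ∀ i → 2 ≤ partSize C i
    parts≥2 = optimal-partition⇒parts≥2 (s≤s m≥1) C-optimal

    T′ℓ-disjoint : ∀ i {x} → x ∈ T′ ℓ → x ∉ T i
    T′ℓ-disjoint i x∈T′ℓ = T̃-disjoint i _ (subst (_ ∈_) (replaceLast-last T T̃) x∈T′ℓ)

    ∣T′ℓ∣≡t : ∣ T′ ℓ ∣ ≡ t
    ∣T′ℓ∣≡t = trans (cong ∣_∣ (replaceLast-last T T̃)) ∣T̃∣≡t

    swap : ∃ (Exchanges (T ℓ) (T′ ℓ))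
    swap = exchange t (∣Tᵢ∣≡t ℓ) ∣T′ℓ∣≡t (λ x∈Tℓ x∈T′ℓ → T′ℓ-disjoint ℓ x∈T′ℓ x∈Tℓ)

    room : k + suc (suc m) * t ≤ n
    room = ≤-trans (+-monoʳ-≤ k (*-monoˡ-≤ t (2+m≤r {r} m≥1 s-choice))) k+rt≤n

    open Replacement k C parts≥2 T T′ ℓ (replaceLast-other T T̃) T′ℓ-disjoint (proj₂ swap) using (numColourings-≤)
    open Witness k t C parts≥2 T T′ ℓ (replaceLast-other T T̃) T′ℓ-disjoint (proj₂ swap) ∣Tᵢ∣≡t ∣T′ℓ∣≡t 1≤t room
                 zero (0≢fromℕ m≥1) large-overlap using (numColourings-6/5)
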